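{- Let $(S,I,O,\to)$ be an LTS with inputs and outputs with finitely many states. Let $D$ be the declaration over the variables $\{X_q\mid q\in S\}$ given by $$D(X_q)=\bigwedge_{a?\in\mathsf{ins}(q)}[\![a?]\!]\bigvee_{q\xrightarrow{a?}q'}X_{q'}\ \wedge\ \bigwedge_{a!\in O}[a!]\bigvee_{q\xrightarrow{a!}q'}X_{q'}\qquad(q\in S).$$ Then for all $p,q\in S$: $([\![D]\!]_{\max},p)\models X_q$ if and only if $p\mathrel{\mathsf{iocos}}q$. (That is, $X_q$ under this declaration is a characteristic formula for $q$ with respect to $\mathsf{iocos}$.)
   Context: Actions: disjoint finite sets $I$ (inputs $a?$) and $O$ (outputs $a!$, including quiescence $\delta!$). An LTS with inputs and outputs is $(S,I,O,\to)$ with $\to\subseteq S\times(I\cup O)\times S$ such that $p\xrightarrow{\delta!}p'$ iff $p=p'$ and $p$ has no $a!$-transition for $a!\in O\setminus\{\delta!\}$. $\mathsf{ins}(p)$ is the set of inputs $a?$ such that $p$ has an $a?$-transition. An iocos-relation $R$ satisfies for every $(p,q)\in R$: (1) $\mathsf{ins}(q)\subseteq\mathsf{ins}(p)$; (2) for every $a?\in\mathsf{ins}(q)$ and $p\xrightarrow{a?}p'$ there is $q\xrightarrow{a?}q'$ with $(p',q')\in R$; (3) for every $a!\in O$ and $p\xrightarrow{a!}p'$ there is $q\xrightarrow{a!}q'$ with $(p',q')\in R$; $\mathsf{iocos}$ is the union of all iocos-relations. Empty disjunctions denote $\mathrm{ff}$, empty conjunctions $\mathrm{tt}$. For an environment $\sigma$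 mapping variables to subsets of $S$: $(\sigma,p)\models X$ iff $p\in\sigma(X)$; Boolean constructs as usual; $(\sigma,p)\models[a!]\phi$ iff $(\sigma,p')\models\phi$ for all $p\xrightarrow{a!}p'$; $(\sigma,p)\models[\![a?]\!]\phi$ iff $p$ has an $a?$-transition and $(\sigma,p')\models\phi$ for all $p\xrightarrow{a?}p'$. A declaration $D$ induces the monotone map $[\![D]\!]$ on environments (ordered pointwise by inclusion), $([\![D]\!]\sigma)(X)=\{p\mid(\sigma,p)\models D(X)\}$; $[\![D]\!]_{\max}$ denotes its greatest fixed point. -}

module Defs where

open import Level using (Level; 0ℓ) renaming (suc to lsuc)
open import Data.Nat using (ℕ)
open import Data.Fin using (Fin)
open import Data.Fin.Properties using (_≟_)
open import Data.Bool using (Bool; true; false)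
open import Data.Sum using (_⊎_; inj₁; inj₂)
open import Data.Product using (Σ; ∃; _×_; _,_)
open import Data.List using (List; []; _∷_; map; filter; allFin)
open import Data.Bool.ListAction using (any)
open import Data.Empty using (⊥)
open import Data.Unit using (⊤)
open import Relation.Nullary using (¬_)
open import Relation.Nullary.Decidable using (does)
open import Relation.Binary.PropositionalEquality using (_≡_)
open import Function.Bundles using (_⇔_)

-- States S = Fin n, inputs I = Fin ni, outputs O = Fin no (disjoint via ⊎),
-- quiescence δ! ∈ O.

Act : ℕ → ℕ → Set
Act ni no = Fin ni ⊎ Fin no

record LTSIO (n ni no : ℕ) : Set where
  field
    trans : Fin n → Act ni no → Fin n → Bool
    δ     : Fin no
  _—_⟶_ : Fin n → Act ni no → Fin n → Set
  p — a ⟶ p' = trans p a p' ≡ true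
  field
    quiescence : ∀ p p' → (p — inj₂ δ ⟶ p') ⇔
                   ((p ≡ p') × (∀ a p'' → ¬ (a ≡ δ) → ¬ (p — inj₂ a ⟶ p'')))

module _ {n ni no : ℕ} (L : LTSIO n ni no) where
  open LTSIO L

  Ins : Fin n → Fin ni → Set
  Ins p a = ∃ λ p' → p — inj₁ a ⟶ p'

  insList : Fin n → List (Fin ni)
  insList p = filter (λ a → any (λ p' → trans p (inj₁ a) p') (allFin n) ≟b true) (allFin ni)
    where
    open import Data.Bool.Properties using () renaming (_≟_ to _≟b_)

  succs : Fin n → Act ni no → List (Fin n)
  succs q a = filter (λ q' → trans q a q' ≟b true) (allFin n)
    where
    open import Data.Bool.Properties using () renaming (_≟_ to _≟b_)

  record IsIocosRel (R : Fin n → Fin n → Set) : Set where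
    field
      ins⊆   : ∀ {p q} → R p q → ∀ a → Ins q a → Ins p a
      inStep : ∀ {p q} → R p q → ∀ a → Ins q a → ∀ p' → p — inj₁ a ⟶ p' →
                 ∃ λ q' → (q — inj₁ a ⟶ q') × R p' q'
      outStep : ∀ {p q} → R p q → ∀ a p' → p — inj₂ a ⟶ p' →
                 ∃ λ q' → (q — inj₂ a ⟶ q') × R p' q'

  _iocos_ : Fin n → Fin n → Set₁
  p iocos q = ∃ λ (R : Fin n → Fin n → Set) → IsIocosRel R × R p q

data Form (V : Set) (ni no : ℕ) : Set where
  var  : V → Form V ni no
  tt ff : Form V ni no
  _∧_ _∨_ : Form V ni no → Form V ni no → Form V ni no
  ⋀ ⋁  : List (Form V ni no) → Form V ni no
  [_!]_  : Fin no → Form V ni no → Form V ni no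
  ⟦_?⟧_  : Fin ni → Form V ni no → Form V ni no

module _ {n ni no : ℕ} (L : LTSIO n ni no) where
  open LTSIO L

  -- Environments: variables X_q (q ∈ S) ↦ subsets of S
  Env : Set₁
  Env = Fin n → Fin n → Set

  mutual
    Sat : Env → Fin n → Form (Fin n) ni no → Set
    Sat σ p (var X) = σ X p
    Sat σ p tt = ⊤
    Sat σ p ff = ⊥
    Sat σ p (φ ∧ ψ) = Sat σ p φ × Sat σ p ψ
    Sat σ p (φ ∨ ψ) = Sat σ p φ ⊎ Sat σ p ψ
    Sat σ p (⋀ φs) = SatAll σ p φs
    Sat σ p (⋁ φs) = SatAny σ p φs
    Sat σ p ([ a !] φ) = ∀ p' → p — inj₂ a ⟶ p' → Sat σ p' φ
    Sat σ p (⟦ a ?⟧ φ) = (∃ λ p' → p — inj₁ a ⟶ p') ×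
                         (∀ p' → p — inj₁ a ⟶ p' → Sat σ p' φ)

    SatAll : Env → Fin n → List (Form (Fin n) ni no) → Set
    SatAll σ p [] = ⊤
    SatAll σ p (φ ∷ φs) = Sat σ p φ × SatAll σ p φs

    SatAny : Env → Fin n → List (Form (Fin n) ni no) → Set
    SatAny σ p [] = ⊥
    SatAny σ p (φ ∷ φs) = Sat σ p φ ⊎ SatAny σ p φs

  Declaration : Set
  Declaration = Fin n → Form (Fin n) ni no

  ⟦_⟧ : Declaration → Env → Env
  ⟦ D ⟧ σ X p = Sat σ p (D X)

  record IsGreatestFixedPoint (D : Declaration) (σ : Env) : Set₁ where
    field
      fixed    : ∀ X p → σ X p ⇔ ⟦ D ⟧ σ X p
      greatest : ∀ (τ : Env) → (∀ X p → τ X p ⇔ ⟦ D ⟧ τ X p) →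
                 ∀ X p → τ X p → σ X p

  charD : Declaration
  charD q =
    ⋀ (map (λ a → ⟦ a ?⟧ ⋁ (map var (succs L q (inj₁ a)))) (insList L q))
    ∧ ⋀ (map (λ a → [ a !] ⋁ (map var (succs L q (inj₂ a)))) (allFin no))

-- Read an environment τ as the relation "p R q iff p ∈ τ(X_q)"; then τ is a fixed point
-- of ⟦charD⟧ exactly when R = IocosStep R, where IocosStep R spells out the three iocos
-- clauses with R as the relation for successors. So the greatest fixed point σ is an
-- iocos-relation. Conversely, iocos itself lives in Set₁ and cannot be an environment, so
-- we compare with the unfoldings iocos[k] of IocosStep from the total relation: every
-- iocos-relation lies below all of them, and being a descending chain of decidable
-- relations on finitely many pairs of states, they become stationary at some K. Then
-- iocos[K] is a fixed point, hence below σ.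
module Submission where

open import Defs
open import Level using (0ℓ)
open import Data.Bool using (Bool; true)
open import Data.Bool.Properties using (T-≡) renaming (_≟_ to _≟ᵇ_)
open import Data.Bool.ListAction using (any)
open import Data.Fin using (Fin)
open import Data.Fin.Properties using (all?; any?)
open import Data.List using ([]; _∷_; map; filter; length; allFin; cartesianProduct)
open import Data.List.Membership.Propositional using (_∈_; lose)
open import Data.List.Membership.Propositional.Properties
  using (∈-filter⁺; ∈-filter⁻; ∈-allFin; ∈-cartesianProduct⁺)
open import Data.List.Relation.Unary.Any using (here; there; satisfied)
open import Data.List.Relation.Unary.Any.Properties using (any⁺; any⁻)
open import Data.List.Relation.Binary.Pointwise using (Pointwise-≡⇒≡)
open import Data.List.Relation.Binary.Sublist.Propositional using (_⊆_; ⊆-refl)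
open import Data.List.Relation.Binary.Sublist.Heterogeneous.Properties
  using (⊆-filter-Sublist; length-mono-≤; toPointwise)
open import Data.Nat using (ℕ; zero; suc; _≤_; _<_)
open import Data.Nat.Properties using (≤-refl; ≤-trans; ≤-pred; n≮0; m≤n⇒m<n∨m≡n)
open import Data.Product using (∃; _×_; _,_; proj₁; proj₂; map₁; map₂; uncurry)
open import Data.Sum using (_⊎_; inj₁; inj₂)
open import Data.Unit using (⊤; tt)
open import Function using (flip; _∘_)
open import Function.Bundles using (_⇔_; mk⇔; Equivalence)
open import Relation.Binary.Core using (Rel; _⇒_)
open import Relation.Binary.Definitions using () renaming (Decidable to Decidable₂)
open import Relation.Binary.PropositionalEquality using (_≡_; refl; sym; subst)
open import Relation.Nullary using (yes; contradiction)
open import Relation.Nullary.Decidable using (_×-dec_; _→-dec_)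
open import Relation.Unary using (Pred; Decidable) renaming (_⊆_ to _⊆₁_)

module _ {a p} {A : Set a} {P Q : Pred A p} (P? : Decidable P) (Q? : Decidable Q) where

  filter-⊆-filter : Q ⊆₁ P → ∀ xs → filter Q? xs ⊆ filter P? xs
  filter-⊆-filter Q⊆P xs = ⊆-filter-Sublist Q? P? {as = xs} (λ { refl → Q⊆P }) ⊆-refl

  filter-shrinks-or-agrees : Q ⊆₁ P → ∀ xs →
    length (filter Q? xs) < length (filter P? xs) ⊎ (∀ {x} → x ∈ xs → P x → Q x)
  filter-shrinks-or-agrees Q⊆P xs with m≤n⇒m<n∨m≡n (length-mono-≤ (filter-⊆-filter Q⊆P xs))
  ... | inj₁ shrinks = inj₁ shrinks
  ... | inj₂ same = inj₂ λ x∈xs Px →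
    proj₂ (∈-filter⁻ Q? {xs = xs} (subst (_ ∈_) (sym filters-equal) (∈-filter⁺ P? x∈xs Px)))
    where
    filters-equal : filter Q? xs ≡ filter P? xs
    filters-equal = Pointwise-≡⇒≡ (toPointwise same (filter-⊆-filter Q⊆P xs))

module _ {a p} {A : Set a} {P : ℕ → Pred A p} (P? : ∀ k → Decidable (P k))
         (P-antitone : ∀ k → P (suc k) ⊆₁ P k) where

  descending-chain-stabilises : ∀ xs → ∃ λ k → ∀ {x} → x ∈ xs → P k x → P (suc k) x
  descending-chain-stabilises xs = from-bound _ 0 ≤-refl
    where
    from-bound : ∀ m k → length (filter (P? k) xs) ≤ m →
                 ∃ λ k → ∀ {x} → x ∈ xs → P k x → P (suc k) x
    from-bound m k bound with filter-shrinks-or-agrees (P? k) (P? (suc k)) (P-antitone k) xs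
    ... | inj₂ stable = k , stable
    from-bound zero    k bound | inj₁ shrinks = contradiction (≤-trans shrinks bound) n≮0
    from-bound (suc m) k bound | inj₁ shrinks = from-bound m (suc k) (≤-pred (≤-trans shrinks bound))

module Iocos {n ni no : ℕ} (L : LTSIO n ni no) where
  open LTSIO L

  _⟶?_ : ∀ p a → Decidable (p — a ⟶_)
  (p ⟶? a) p' = trans p a p' ≟ᵇ true

  Ins? : ∀ q → Decidable (Ins L q)
  Ins? q a = any? (q ⟶? inj₁ a)

  ∈-succs⁺ : ∀ {q a q'} → q — a ⟶ q' → q' ∈ succs L q a
  ∈-succs⁺ {q} {a} {q'} = ∈-filter⁺ (q ⟶? a) (∈-allFin q')

  ∈-succs⁻ : ∀ {q a q'} → q' ∈ succs L q a → q — a ⟶ q'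
  ∈-succs⁻ {q} {a} = proj₂ ∘ ∈-filter⁻ (q ⟶? a) {xs = allFin n}

  hasInput : Fin n → Fin ni → Bool
  hasInput q a = any (λ q' → trans q (inj₁ a) q') (allFin n)

  ∈-insList⁺ : ∀ {q a} → Ins L q a → a ∈ insList L q
  ∈-insList⁺ {q} {a} (q' , q⟶q') =
    ∈-filter⁺ (λ a → hasInput q a ≟ᵇ true) (∈-allFin a)
      (Equivalence.to T-≡ (any⁺ _ (lose (∈-allFin q') (Equivalence.from T-≡ q⟶q'))))

  ∈-insList⁻ : ∀ {q a} → a ∈ insList L q → Ins L q a
  ∈-insList⁻ {q} a∈ =
    map₂ (Equivalence.to T-≡) (satisfied (any⁻ _ (allFin n) (Equivalence.from T-≡
      (proj₂ (∈-filter⁻ (λ a → hasInput q a ≟ᵇ true) {xs = allFin ni} a∈)))))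

  InsIncluded : Rel (Fin n) 0ℓ
  InsIncluded p q = ∀ a → Ins L q a → Ins L p a

  InputsSimulated : Rel (Fin n) 0ℓ → Rel (Fin n) 0ℓ
  InputsSimulated R p q =
    ∀ a → Ins L q a → ∀ p' → p — inj₁ a ⟶ p' → ∃ λ q' → q — inj₁ a ⟶ q' × R p' q'

  OutputsSimulated : Rel (Fin n) 0ℓ → Rel (Fin n) 0ℓ
  OutputsSimulated R p q =
    ∀ a p' → p — inj₂ a ⟶ p' → ∃ λ q' → q — inj₂ a ⟶ q' × R p' q'

  IocosStep : Rel (Fin n) 0ℓ → Rel (Fin n) 0ℓ
  IocosStep R p q = InsIncluded p q × InputsSimulated R p q × OutputsSimulated R p q

  IocosStep-mono : ∀ {R R'} → R ⇒ R' → IocosStep R ⇒ IocosStep R'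
  IocosStep-mono R⇒R' (ins⊆ , inStep , outStep) =
    ins⊆ ,
    (λ a a∈ p' p⟶p' → map₂ (map₂ R⇒R') (inStep a a∈ p' p⟶p')) ,
    (λ a p' p⟶p' → map₂ (map₂ R⇒R') (outStep a p' p⟶p'))

  IocosStep? : ∀ {R} → Decidable₂ R → Decidable₂ (IocosStep R)
  IocosStep? R? p q =
    all? (λ a → Ins? q a →-dec Ins? p a) ×-dec
    all? (λ a → Ins? q a →-dec all? (λ p' → (p ⟶? inj₁ a) p' →-dec
      any? (λ q' → (q ⟶? inj₁ a) q' ×-dec R? p' q'))) ×-dec
    all? (λ a → all? (λ p' → (p ⟶? inj₂ a) p' →-dec
      any? (λ q' → (q ⟶? inj₂ a) q' ×-dec R? p' q')))

  IsIocosRel⇒⊆IocosStep : ∀ {R} → IsIocosRel L R → R ⇒ IocosStep R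
  IsIocosRel⇒⊆IocosStep isR Rpq = ins⊆ Rpq , inStep Rpq , outStep Rpq
    where open IsIocosRel isR

  ⊆IocosStep⇒IsIocosRel : ∀ {R} → R ⇒ IocosStep R → IsIocosRel L R
  ⊆IocosStep⇒IsIocosRel R⇒step = record
    { ins⊆   = proj₁ ∘ R⇒step
    ; inStep  = proj₁ ∘ proj₂ ∘ R⇒step
    ; outStep = proj₂ ∘ proj₂ ∘ R⇒step
    }

  inputClause : Fin n → Fin ni → Form (Fin n) ni no
  inputClause q a = ⟦ a ?⟧ ⋁ (map var (succs L q (inj₁ a)))

  outputClause : Fin n → Fin no → Form (Fin n) ni no
  outputClause q a = [ a !] ⋁ (map var (succs L q (inj₂ a)))

  module _ (τ : Env L) where

    SatAll-map⁺ : ∀ {A : Set} (f : A → Form (Fin n) ni no) xs {p} →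
                  (∀ {x} → x ∈ xs → Sat L τ p (f x)) → SatAll L τ p (map f xs)
    SatAll-map⁺ f []       sat = tt
    SatAll-map⁺ f (x ∷ xs) sat = sat (here refl) , SatAll-map⁺ f xs (sat ∘ there)

    SatAll-map⁻ : ∀ {A : Set} (f : A → Form (Fin n) ni no) xs {p x} →
                  SatAll L τ p (map f xs) → x ∈ xs → Sat L τ p (f x)
    SatAll-map⁻ f (x ∷ xs) (sat , _)    (here refl) = sat
    SatAll-map⁻ f (x ∷ xs) (_   , sats) (there x∈)  = SatAll-map⁻ f xs sats x∈

    SatAny-vars⁺ : ∀ xs {p x} → x ∈ xs → τ x p → SatAny L τ p (map var xs)
    SatAny-vars⁺ (x ∷ xs) (here refl) sat = inj₁ sat
    SatAny-vars⁺ (x ∷ xs) (there x∈)  sat = inj₂ (SatAny-vars⁺ xs x∈ sat)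

    SatAny-vars⁻ : ∀ xs {p} → SatAny L τ p (map var xs) → ∃ λ x → x ∈ xs × τ x p
    SatAny-vars⁻ (x ∷ xs) (inj₁ sat) = x , here refl , sat
    SatAny-vars⁻ (x ∷ xs) (inj₂ sat) = map₂ (map₁ there) (SatAny-vars⁻ xs sat)

    Sat-charD⇒IocosStep : ∀ {p q} → Sat L τ p (charD L q) → IocosStep (flip τ) p q
    Sat-charD⇒IocosStep {p} {q} (sat-ins , sat-outs) = ins⊆ , inStep , outStep
      where
      sat-input : ∀ {a} → Ins L q a → Sat L τ p (inputClause q a)
      sat-input q-a = SatAll-map⁻ (inputClause q) (insList L q) sat-ins (∈-insList⁺ q-a)

      ins⊆ : InsIncluded p q
      ins⊆ a q-a = proj₁ (sat-input q-a)

      inStep : InputsSimulated (flip τ) p q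
      inStep a q-a p' p⟶p' =
        map₂ (map₁ ∈-succs⁻) (SatAny-vars⁻ (succs L q (inj₁ a)) (proj₂ (sat-input q-a) p' p⟶p'))

      outStep : OutputsSimulated (flip τ) p q
      outStep a p' p⟶p' =
        map₂ (map₁ ∈-succs⁻) (SatAny-vars⁻ (succs L q (inj₂ a))
          (SatAll-map⁻ (outputClause q) (allFin no) sat-outs (∈-allFin a) p' p⟶p'))

    IocosStep⇒Sat-charD : ∀ {p q} → IocosStep (flip τ) p q → Sat L τ p (charD L q)
    IocosStep⇒Sat-charD {p} {q} (ins⊆ , inStep , outStep) =
      SatAll-map⁺ (inputClause q) (insList L q) sat-input ,
      SatAll-map⁺ (outputClause q) (allFin no) sat-output
      where
      sat-input : ∀ {a} → a ∈ insList L q → Sat L τ p (inputClause q a)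
      sat-input {a} a∈ = ins⊆ a q-a , λ p' p⟶p' →
        let q' , q⟶q' , τq'p' = inStep a q-a p' p⟶p'
        in SatAny-vars⁺ (succs L q (inj₁ a)) (∈-succs⁺ q⟶q') τq'p'
        where
        q-a : Ins L q a
        q-a = ∈-insList⁻ a∈

      sat-output : ∀ {a} → a ∈ allFin no → Sat L τ p (outputClause q a)
      sat-output {a} _ p' p⟶p' =
        let q' , q⟶q' , τq'p' = outStep a p' p⟶p'
        in SatAny-vars⁺ (succs L q (inj₂ a)) (∈-succs⁺ q⟶q') τq'p'

  fixedPoint⇒IsIocosRel : (τ : Env L) → (∀ X p → τ X p ⇔ ⟦_⟧ L (charD L) τ X p) →
                          IsIocosRel L (flip τ)
  fixedPoint⇒IsIocosRel τ fixed =
    ⊆IocosStep⇒IsIocosRel (Sat-charD⇒IocosStep τ ∘ Equivalence.to (fixed _ _))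

  iocos[_] : ℕ → Rel (Fin n) 0ℓ
  iocos[ zero  ] p q = ⊤
  iocos[ suc k ]     = IocosStep iocos[ k ]

  iocos[]-antitone : ∀ k → iocos[ suc k ] ⇒ iocos[ k ]
  iocos[]-antitone zero    _    = tt
  iocos[]-antitone (suc k) step = IocosStep-mono (iocos[]-antitone k) step

  iocos[]? : ∀ k → Decidable₂ iocos[ k ]
  iocos[]? zero    p q = yes tt
  iocos[]? (suc k)     = IocosStep? (iocos[]? k)

  IsIocosRel⇒⊆iocos[] : ∀ {R} → IsIocosRel L R → ∀ k → R ⇒ iocos[ k ]
  IsIocosRel⇒⊆iocos[] isR zero    _   = tt
  IsIocosRel⇒⊆iocos[] isR (suc k) Rpq =
    IocosStep-mono (IsIocosRel⇒⊆iocos[] isR k) (IsIocosRel⇒⊆IocosStep isR Rpq)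

  iocos[]-stabilises : ∃ λ K → iocos[ K ] ⇒ iocos[ suc K ]
  iocos[]-stabilises with descending-chain-stabilises (λ k → uncurry (iocos[]? k))
                            (λ k → iocos[]-antitone k) (cartesianProduct (allFin n) (allFin n))
  ... | K , stable = K , λ {p} {q} → stable (∈-cartesianProduct⁺ (∈-allFin p) (∈-allFin q))

  stable-iocos[]-isFixedPoint : ∀ K → iocos[ K ] ⇒ iocos[ suc K ] →
    ∀ X p → flip iocos[ K ] X p ⇔ ⟦_⟧ L (charD L) (flip iocos[ K ]) X p
  stable-iocos[]-isFixedPoint K stable X p = mk⇔
    (IocosStep⇒Sat-charD (flip iocos[ K ]) ∘ stable)
    (iocos[]-antitone K ∘ Sat-charD⇒IocosStep (flip iocos[ K ]))

proposition6 : ∀ {n ni no : ℕ} (L : LTSIO n ni no) (σ : Env L) →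
                 IsGreatestFixedPoint L (charD L) σ →
                 ∀ (p q : Fin n) → Sat L σ p (var q) ⇔ _iocos_ L p q
proposition6 L σ gfp p q with Iocos.iocos[]-stabilises L
... | K , stable = mk⇔
  (λ σqp → flip σ , fixedPoint⇒IsIocosRel σ fixed , σqp)
  (λ { (R , isR , Rpq) →
    greatest (flip iocos[ K ]) (stable-iocos[]-isFixedPoint K stable) q p
             (IsIocosRel⇒⊆iocos[] isR K Rpq) })
  where
  open Iocos L
  open IsGreatestFixedPoint gfp
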